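{- Let $n \ge 2$ be an integer and let $S_n$ be the star with center $0$ and leaves $1,\dots,n$. Then the domination number of the $2$-token graph of $S_n$ satisfies \[\gamma(F_2(S_n)) = n-1.\]
   Context: For a simple graph $G$ and an integer $k$ with $1 \le k \le |V(G)|-1$, the $k$-token graph $F_k(G)$ is the graph whose vertices are the $k$-element subsets of $V(G)$, two of them being adjacent if and only if their symmetric difference is a pair $\{u,v\}$ with $uv$ an edge of $G$. The star $S_n$ has vertex set $\{0\}\cup\{1,\dots,n\}$ and edges $\{0,i\}$ for $1\le i\le n$. A dominating set of a graph $H$ is a set $D\subseteq V(H)$ such that every vertex of $H$ is in $D$ or has a neighbor in $D$; the domination number $\gamma(H)$ is the minimum size of a dominating set. -}

module Defs where

open import Data.Nat using (ℕ; zero; suc; _≤_)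
open import Data.Fin using (Fin; zero; suc)
open import Data.Fin.Subset using (Subset; ⁅_⁆; _∪_; _─_; ∣_∣)
open import Data.Product using (Σ; _×_; ∃; ∃-syntax)
open import Data.Sum using (_⊎_)
open import Data.Unit using (⊤)
open import Data.Empty using (⊥)
open import Data.List using (List; length)
open import Data.List.Relation.Unary.Any using (Any)
open import Data.List.Relation.Unary.Unique.Propositional using (Unique)
open import Relation.Binary.PropositionalEquality using (_≡_)

record Graph : Set₁ where
  field
    Vertex : Set
    Adj    : Vertex → Vertex → Set
open Graph public

StarAdj : ∀ {n} → Fin (suc n) → Fin (suc n) → Set
StarAdj zero    zero    = ⊥
StarAdj zero    (suc _) = ⊤
StarAdj (suc _) zero    = ⊤
StarAdj (suc _) (suc _) = ⊥

Star : ℕ → Graph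
Star n = record { Vertex = Fin (suc n) ; Adj = StarAdj }

_△_ : ∀ {m} → Subset m → Subset m → Subset m
A △ B = (A ─ B) ∪ (B ─ A)

TokenGraph : ∀ {m} → (Fin m → Fin m → Set) → ℕ → Graph
TokenGraph {m} adj k = record
  { Vertex = Σ (Subset m) (λ A → ∣ A ∣ ≡ k)
  ; Adj    = λ A B → ∃[ u ] ∃[ v ] (adj u v × (Σ.proj₁ A △ Σ.proj₁ B) ≡ (⁅ u ⁆ ∪ ⁅ v ⁆))
  }

IsDominatingSet : (H : Graph) → List (Vertex H) → Set
IsDominatingSet H D =
  Unique D × (∀ x → Any (λ d → d ≡ x ⊎ Adj H d x) D)

DominationNumber : Graph → ℕ → Set
DominationNumber H d =
  (Σ (List (Vertex H)) (λ D → IsDominatingSet H D × length D ≡ d))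
  × (∀ D → IsDominatingSet H D → d ≤ length D)

{-# OPTIONS --safe #-}
-- The 2-token graph of the star S_n is the subdivision of K_n: the vertices {0,a} play the
-- role of the vertices of K_n, and {0,a} is adjacent exactly to the vertices {a,b}.
-- A dominating set of size n − 1 is {1,2} together with all {0,j} for j ≥ 3.
-- Conversely, the only common neighbour of {a,i} and {a,j} (i ≠ j) is {0,a}. So if a dominating
-- set D misses some {0,a}, the n − 1 vertices {a,i} need pairwise distinct dominators in D;
-- otherwise D contains all n vertices {0,a}.
module Submission where

open import Defs
open import Data.Nat using (ℕ; _≤_; _∸_; zero; suc; s≤s; z≤n)
import Data.Nat.Properties as ℕ
open import Data.Bool using (true; false)
import Data.Bool as Bool
open import Data.Fin using (Fin; zero; suc; punchIn)
import Data.Fin.Properties as Fin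
open import Data.Fin.Subset using (Subset; ⁅_⁆; _∪_; _─_; ∣_∣; ⊥; _∈_; _∉_)
open import Data.Fin.Subset.Properties
  using (∪-identityˡ; ∪-identityʳ; ∪-comm; ∣⁅x⁆∣≡1; x∈⁅x⁆; x∈⁅y⁆⇒x≡y; x≢y⇒x∉⁅y⁆;
         x∈p∪q⁺; x∈p∪q⁻; x∈p∧x∉q⇒x∈p─q)
open import Data.Vec using ([]; _∷_; tail)
import Data.Vec.Properties as Vec
open import Data.List using (List; _∷_; length; lookup; tabulate)
open import Data.List.Properties using (length-tabulate)
open import Data.List.Relation.Unary.Any using (Any; here; there; index; any?)
import Data.List.Relation.Unary.Any.Properties as Any
import Data.List.Relation.Unary.All.Properties as All
import Data.List.Relation.Unary.Unique.Propositional.Properties as Unique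
open import Data.List.Relation.Unary.AllPairs using (_∷_)
open import Data.List.Relation.Unary.Unique.Propositional using (Unique)
open import Data.List.Membership.Propositional using () renaming (_∈_ to _∈ᴸ_)
open import Data.List.Membership.Propositional.Properties using (∈-lookup)
open import Data.Product using (_×_; _,_; proj₁; ∃; ∃₂)
open import Data.Product.Properties using (≡-dec)
open import Data.Sum using (_⊎_; inj₁; inj₂)
open import Data.Unit using (tt)
open import Data.Empty using (⊥-elim)
open import Function using (_∘_)
open import Function.Definitions using (Injective)
open import Relation.Nullary using (yes; no)
open import Relation.Binary.Definitions using (DecidableEquality)
open import Relation.Binary.PropositionalEquality using (_≡_; _≢_; refl; sym; trans; cong; subst)

∣p∣≡0⇒p≡⊥ : ∀ {k} (p : Subset k) → ∣ p ∣ ≡ 0 → p ≡ ⊥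
∣p∣≡0⇒p≡⊥ []          _ = refl
∣p∣≡0⇒p≡⊥ (false ∷ p) e = cong (false ∷_) (∣p∣≡0⇒p≡⊥ p e)

∣p∣≡1⇒p≡⁅x⁆ : ∀ {k} (p : Subset k) → ∣ p ∣ ≡ 1 → ∃ λ x → p ≡ ⁅ x ⁆
∣p∣≡1⇒p≡⁅x⁆ (true ∷ p)  e = zero , cong (true ∷_) (∣p∣≡0⇒p≡⊥ p (ℕ.suc-injective e))
∣p∣≡1⇒p≡⁅x⁆ (false ∷ p) e with ∣p∣≡1⇒p≡⁅x⁆ p e
... | x , refl = suc x , refl

∣p∣≡2⇒p≡⁅x⁆∪⁅y⁆ : ∀ {k} (p : Subset k) → ∣ p ∣ ≡ 2 → ∃₂ λ x y → x ≢ y × p ≡ ⁅ x ⁆ ∪ ⁅ y ⁆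
∣p∣≡2⇒p≡⁅x⁆∪⁅y⁆ (true ∷ p) e with ∣p∣≡1⇒p≡⁅x⁆ p (ℕ.suc-injective e)
... | y , refl = zero , suc y , (λ ()) , cong (true ∷_) (sym (∪-identityˡ ⁅ y ⁆))
∣p∣≡2⇒p≡⁅x⁆∪⁅y⁆ (false ∷ p) e with ∣p∣≡2⇒p≡⁅x⁆∪⁅y⁆ p e
... | x , y , x≢y , refl = suc x , suc y , x≢y ∘ Fin.suc-injective , refl

∣⁅x⁆∪⁅y⁆∣≡2 : ∀ {k} {x y : Fin k} → x ≢ y → ∣ ⁅ x ⁆ ∪ ⁅ y ⁆ ∣ ≡ 2
∣⁅x⁆∪⁅y⁆∣≡2 {x = zero}  {zero}  x≢y = ⊥-elim (x≢y refl)
∣⁅x⁆∪⁅y⁆∣≡2 {x = zero}  {suc y} _   = cong suc (trans (cong ∣_∣ (∪-identityˡ ⁅ y ⁆)) (∣⁅x⁆∣≡1 y))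
∣⁅x⁆∪⁅y⁆∣≡2 {x = suc x} {zero}  _   = cong suc (trans (cong ∣_∣ (∪-identityʳ ⁅ x ⁆)) (∣⁅x⁆∣≡1 x))
∣⁅x⁆∪⁅y⁆∣≡2 {x = suc x} {suc y} x≢y = ∣⁅x⁆∪⁅y⁆∣≡2 (x≢y ∘ cong suc)

⁅⁆-injective : ∀ {k} {x y : Fin k} → ⁅ x ⁆ ≡ ⁅ y ⁆ → x ≡ y
⁅⁆-injective {x = x} {y} eq = x∈⁅y⁆⇒x≡y y (subst (x ∈_) eq (x∈⁅x⁆ x))

⁅x⁆∪⁅y⁆-injectiveʳ : ∀ {k} {x y z : Fin k} → x ≢ y → ⁅ x ⁆ ∪ ⁅ y ⁆ ≡ ⁅ x ⁆ ∪ ⁅ z ⁆ → y ≡ z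
⁅x⁆∪⁅y⁆-injectiveʳ {x = x} {y} {z} x≢y eq
  with x∈p∪q⁻ ⁅ x ⁆ ⁅ z ⁆ (subst (y ∈_) eq (x∈p∪q⁺ (inj₂ (x∈⁅x⁆ y))))
... | inj₁ y∈⁅x⁆ = ⊥-elim (x≢y (sym (x∈⁅y⁆⇒x≡y x y∈⁅x⁆)))
... | inj₂ y∈⁅z⁆ = x∈⁅y⁆⇒x≡y z y∈⁅z⁆

△-identityˡ : ∀ {k} (p : Subset k) → ⊥ △ p ≡ p
△-identityˡ []          = refl
△-identityˡ (true ∷ p)  = cong (true ∷_) (△-identityˡ p)
△-identityˡ (false ∷ p) = cong (false ∷_) (△-identityˡ p)

△-self : ∀ {k} (p : Subset k) → p △ p ≡ ⊥
△-self []          = refl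
△-self (true ∷ p)  = cong (false ∷_) (△-self p)
△-self (false ∷ p) = cong (false ∷_) (△-self p)

△-comm : ∀ {k} (p q : Subset k) → p △ q ≡ q △ p
△-comm p q = ∪-comm (p ─ q) (q ─ p)

x∉p∧x∈q⇒x∈p△q : ∀ {k} {p q : Subset k} {x} → x ∉ p → x ∈ q → x ∈ p △ q
x∉p∧x∈q⇒x∈p△q x∉p x∈q = x∈p∪q⁺ (inj₂ (x∈p∧x∉q⇒x∈p─q x∈q x∉p))

⁅x⁆△⁅x⁆∪⁅y⁆≡⁅y⁆ : ∀ {k} {x y : Fin k} → x ≢ y → ⁅ x ⁆ △ (⁅ x ⁆ ∪ ⁅ y ⁆) ≡ ⁅ y ⁆
⁅x⁆△⁅x⁆∪⁅y⁆≡⁅y⁆ {x = zero}  {zero}  x≢y = ⊥-elim (x≢y refl)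
⁅x⁆△⁅x⁆∪⁅y⁆≡⁅y⁆ {x = zero}  {suc y} _   =
  cong (false ∷_) (trans (△-identityˡ (⊥ ∪ ⁅ y ⁆)) (∪-identityˡ ⁅ y ⁆))
⁅x⁆△⁅x⁆∪⁅y⁆≡⁅y⁆ {x = suc x} {zero}  _   =
  cong (true ∷_) (trans (cong (⁅ x ⁆ △_) (∪-identityʳ ⁅ x ⁆)) (△-self ⁅ x ⁆))
⁅x⁆△⁅x⁆∪⁅y⁆≡⁅y⁆ {x = suc x} {suc y} x≢y = cong (false ∷_) (⁅x⁆△⁅x⁆∪⁅y⁆≡⁅y⁆ (x≢y ∘ cong suc))

⁅z⁆△⁅x⁆∪⁅y⁆≡⁅w⁆⇒z≡x⊎z≡y : ∀ {k} {x y z w : Fin k} → x ≢ y →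
                            ⁅ z ⁆ △ (⁅ x ⁆ ∪ ⁅ y ⁆) ≡ ⁅ w ⁆ → z ≡ x ⊎ z ≡ y
⁅z⁆△⁅x⁆∪⁅y⁆≡⁅w⁆⇒z≡x⊎z≡y {x = x} {y} {z} {w} x≢y eq with z Fin.≟ x | z Fin.≟ y
... | yes z≡x | _       = inj₁ z≡x
... | no _    | yes z≡y = inj₂ z≡y
... | no z≢x  | no z≢y  =
  -- x and y would both lie in the symmetric difference ⁅ w ⁆
  ⊥-elim (x≢y (trans (≡w (x∈p∪q⁺ (inj₁ (x∈⁅x⁆ x))) (z≢x ∘ sym))
                     (sym (≡w (x∈p∪q⁺ (inj₂ (x∈⁅x⁆ y))) (z≢y ∘ sym)))))
  where
  ≡w : ∀ {v} → v ∈ ⁅ x ⁆ ∪ ⁅ y ⁆ → v ≢ z → v ≡ w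
  ≡w v∈ v≢z = x∈⁅y⁆⇒x≡y w (subst (_ ∈_) eq (x∉p∧x∈q⇒x∈p△q (x≢y⇒x∉⁅y⁆ v≢z) v∈))

Dominates : (H : Graph) → Vertex H → Vertex H → Set
Dominates H d x = d ≡ x ⊎ Adj H d x

injective-∈⇒≤-length : ∀ {A : Set} {m} (xs : List A) (f : Fin m → A) →
                       Injective _≡_ _≡_ f → (∀ i → f i ∈ᴸ xs) → m ≤ length xs
injective-∈⇒≤-length xs f f-injective f∈xs = Fin.injective⇒≤ index-injective
  where
  index-injective : Injective _≡_ _≡_ (index ∘ f∈xs)
  index-injective {i} {j} eq = f-injective (trans (Any.lookup-index (f∈xs i))
    (trans (cong (lookup xs) eq) (sym (Any.lookup-index (f∈xs j)))))

packing⇒≤-length : ∀ {H : Graph} {m} (D : List (Vertex H)) → (∀ x → Any (λ d → Dominates H d x) D) →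
                   (x : Fin m → Vertex H) →
                   (∀ {d i j} → d ∈ᴸ D → Dominates H d (x i) → Dominates H d (x j) → i ≡ j) →
                   m ≤ length D
packing⇒≤-length {H} {m} D dominated x packing =
  injective-∈⇒≤-length D dominator dominator-injective (λ i → ∈-lookup (index (dominated (x i))))
  where
  dominator : Fin m → Vertex H
  dominator i = lookup D (index (dominated (x i)))
  dominator-injective : Injective _≡_ _≡_ dominator
  dominator-injective {i} {j} eq = packing (∈-lookup (index (dominated (x i))))
    (Any.lookup-index (dominated (x i)))
    (subst (λ d → Dominates H d (x j)) (sym eq) (Any.lookup-index (dominated (x j))))

F₂S : ℕ → Graph
F₂S n = TokenGraph (StarAdj {n}) 2

≡-from-tokens : ∀ {n} {A B : Vertex (F₂S n)} → proj₁ A ≡ proj₁ B → A ≡ B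
≡-from-tokens {A = s , p} {B = .s , q} refl = cong (s ,_) (ℕ.≡-irrelevant p q)

_≟ᵥ_ : ∀ {n} → DecidableEquality (Vertex (F₂S n))
_≟ᵥ_ = ≡-dec (Vec.≡-dec Bool._≟_) (λ p q → yes (ℕ.≡-irrelevant p q))

-- Adj (F₂S n) (A , p) (B , q) unfolds to StarMove A B; stating the adjacency lemmas on token
-- sets keeps the size proofs p, q, which Agda cannot infer, out of their statements.
StarMove : ∀ {n} → Subset (suc n) → Subset (suc n) → Set
StarMove A B = ∃₂ λ u v → StarAdj u v × (A △ B) ≡ ⁅ u ⁆ ∪ ⁅ v ⁆

-- A vertex of F₂S n is written b ∷ L: b tells whether the centre carries a token and L is the
-- set of occupied leaves, leaf a of S_n being the vertex suc a.
hubPair : ∀ {n} → Fin n → Vertex (F₂S n)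
hubPair a = true ∷ ⁅ a ⁆ , cong suc (∣⁅x⁆∣≡1 a)

leafPair : ∀ {n} (a b : Fin n) → a ≢ b → Vertex (F₂S n)
leafPair a b a≢b = false ∷ (⁅ a ⁆ ∪ ⁅ b ⁆) , ∣⁅x⁆∪⁅y⁆∣≡2 a≢b

hubPair-injective : ∀ {n} {a b : Fin n} → hubPair a ≡ hubPair b → a ≡ b
hubPair-injective = ⁅⁆-injective ∘ cong (tail ∘ proj₁)

leafPair-injectiveʳ : ∀ {n} {a i j : Fin n} {a≢i : a ≢ i} {a≢j : a ≢ j} →
                      leafPair a i a≢i ≡ leafPair a j a≢j → i ≡ j
leafPair-injectiveʳ {a≢i = a≢i} = ⁅x⁆∪⁅y⁆-injectiveʳ a≢i ∘ cong (tail ∘ proj₁)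

token-to-leaf : ∀ {n} (L M : Subset n) w → L △ M ≡ ⁅ w ⁆ → StarMove (true ∷ L) (false ∷ M)
token-to-leaf L M w eq = zero , suc w , tt , cong (true ∷_) (trans eq (sym (∪-identityˡ ⁅ w ⁆)))

token-to-centre : ∀ {n} (L M : Subset n) w → L △ M ≡ ⁅ w ⁆ → StarMove (false ∷ M) (true ∷ L)
token-to-centre L M w eq =
  suc w , zero , tt , cong (true ∷_) (trans (△-comm M L) (trans eq (sym (∪-identityʳ ⁅ w ⁆))))

StarMove⇒token-to-leaf : ∀ {n} {b} {L M : Subset n} → StarMove (b ∷ L) (false ∷ M) →
                         b ≡ true × ∃ λ w → L △ M ≡ ⁅ w ⁆
StarMove⇒token-to-leaf (zero  , zero  , () , _)
StarMove⇒token-to-leaf (suc _ , suc _ , () , _)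
StarMove⇒token-to-leaf {b = true}  (zero  , suc w , _ , eq) =
  refl , w , trans (cong tail eq) (∪-identityˡ ⁅ w ⁆)
StarMove⇒token-to-leaf {b = true}  (suc w , zero  , _ , eq) =
  refl , w , trans (cong tail eq) (∪-identityʳ ⁅ w ⁆)
StarMove⇒token-to-leaf {b = false} (zero  , suc _ , _ , ())
StarMove⇒token-to-leaf {b = false} (suc _ , zero  , _ , ())

leafPair-dominators : ∀ {n} {a i : Fin n} (a≢i : a ≢ i) {d} →
                      Dominates (F₂S n) d (leafPair a i a≢i) →
                      d ≡ leafPair a i a≢i ⊎ d ≡ hubPair a ⊎ d ≡ hubPair i
leafPair-dominators a≢i (inj₁ d≡x) = inj₁ d≡x
leafPair-dominators a≢i {b ∷ L , ∣d∣≡2} (inj₂ adj) with StarMove⇒token-to-leaf {b = b} {L} adj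
... | refl , w , L△≡⁅w⁆ with ∣p∣≡1⇒p≡⁅x⁆ L (ℕ.suc-injective ∣d∣≡2)
... | c , refl with ⁅z⁆△⁅x⁆∪⁅y⁆≡⁅w⁆⇒z≡x⊎z≡y a≢i L△≡⁅w⁆
... | inj₁ refl = inj₂ (inj₁ (≡-from-tokens refl))
... | inj₂ refl = inj₂ (inj₂ (≡-from-tokens refl))

common-dominator : ∀ {n} {a i j : Fin n} (a≢i : a ≢ i) (a≢j : a ≢ j) → i ≢ j → ∀ {d} →
                   Dominates (F₂S n) d (leafPair a i a≢i) → Dominates (F₂S n) d (leafPair a j a≢j) →
                   d ≡ hubPair a
common-dominator a≢i a≢j i≢j di dj with leafPair-dominators a≢i di | leafPair-dominators a≢j dj
... | inj₂ (inj₁ d≡hub) | _                 = d≡hub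
... | _                 | inj₂ (inj₁ d≡hub) = d≡hub
... | inj₁ refl         | inj₁ eq           = ⊥-elim (i≢j (leafPair-injectiveʳ eq))
... | inj₁ refl         | inj₂ (inj₂ ())
... | inj₂ (inj₂ refl)  | inj₁ ()
... | inj₂ (inj₂ refl)  | inj₂ (inj₂ eq)    = ⊥-elim (i≢j (hubPair-injective eq))

F₂S-domination-≥ : ∀ m (D : List (Vertex (F₂S (suc m)))) → IsDominatingSet (F₂S (suc m)) D →
                   m ≤ length D
F₂S-domination-≥ m D (_ , dominated) with Fin.all? (λ a → any? (hubPair a ≟ᵥ_) D)
... | yes hubs∈D = ℕ.≤-trans (ℕ.n≤1+n m) (injective-∈⇒≤-length D hubPair hubPair-injective hubs∈D)
... | no ¬hubs∈D with Fin.¬∀⟶∃¬ _ _ (λ a → any? (hubPair a ≟ᵥ_) D) ¬hubs∈D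
... | a , hub∉D = packing⇒≤-length D dominated spoke separated
  where
  a≢ : ∀ k → a ≢ punchIn a k
  a≢ k = Fin.punchInᵢ≢i a k ∘ sym
  spoke : Fin m → Vertex (F₂S (suc m))
  spoke k = leafPair a (punchIn a k) (a≢ k)
  separated : ∀ {d k l} → d ∈ᴸ D →
              Dominates (F₂S (suc m)) d (spoke k) → Dominates (F₂S (suc m)) d (spoke l) → k ≡ l
  separated {k = k} {l} d∈D dk dl with k Fin.≟ l
  ... | yes k≡l = k≡l
  ... | no k≢l  = ⊥-elim (hub∉D (subst (_∈ᴸ D) d≡hub d∈D))
    where
    d≡hub = common-dominator (a≢ k) (a≢ l) (k≢l ∘ Fin.punchIn-injective a k l) dk dl

dominatingSet : ∀ k → List (Vertex (F₂S (suc (suc k))))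
dominatingSet k = leafPair zero (suc zero) (λ ()) ∷ tabulate (λ j → hubPair (suc (suc j)))

dominatingSet-dominates : ∀ k x → Any (λ d → Dominates (F₂S (suc (suc k))) d x) (dominatingSet k)
dominatingSet-dominates k (true ∷ true ∷ true ∷ r , ())
dominatingSet-dominates k (true ∷ true ∷ false ∷ r , p)
  with refl ← ∣p∣≡0⇒p≡⊥ r (ℕ.suc-injective (ℕ.suc-injective p)) =
  here (inj₂ (token-to-centre ⁅ zero ⁆ (⁅ zero ⁆ ∪ ⁅ suc zero ⁆) (suc zero)
    (⁅x⁆△⁅x⁆∪⁅y⁆≡⁅y⁆ {x = zero} {suc zero} λ ())))
dominatingSet-dominates k (true ∷ false ∷ true ∷ r , p)
  with refl ← ∣p∣≡0⇒p≡⊥ r (ℕ.suc-injective (ℕ.suc-injective p)) =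
  here (inj₂ (token-to-centre ⁅ suc zero ⁆ (⁅ zero ⁆ ∪ ⁅ suc zero ⁆) zero
    (trans (cong (⁅ suc zero ⁆ △_) (∪-comm ⁅ zero ⁆ ⁅ suc zero ⁆))
           (⁅x⁆△⁅x⁆∪⁅y⁆≡⁅y⁆ {x = suc zero} {zero} λ ()))))
dominatingSet-dominates k (true ∷ false ∷ false ∷ r , p)
  with j , refl ← ∣p∣≡1⇒p≡⁅x⁆ r (ℕ.suc-injective p) =
  there (Any.tabulate⁺ j (inj₁ (≡-from-tokens refl)))
dominatingSet-dominates k (false ∷ true ∷ true ∷ r , p)
  with refl ← ∣p∣≡0⇒p≡⊥ r (ℕ.suc-injective (ℕ.suc-injective p)) =
  here (inj₁ (≡-from-tokens (cong (λ s → false ∷ true ∷ true ∷ s) (∪-identityˡ ⊥))))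
dominatingSet-dominates k (false ∷ true ∷ false ∷ r , p)
  with j , refl ← ∣p∣≡1⇒p≡⁅x⁆ r (ℕ.suc-injective p) =
  there (Any.tabulate⁺ j (inj₂ (token-to-leaf (false ∷ false ∷ ⁅ j ⁆) (true ∷ false ∷ ⁅ j ⁆) zero
    (cong (λ s → true ∷ false ∷ s) (△-self ⁅ j ⁆)))))
dominatingSet-dominates k (false ∷ false ∷ true ∷ r , p)
  with j , refl ← ∣p∣≡1⇒p≡⁅x⁆ r (ℕ.suc-injective p) =
  there (Any.tabulate⁺ j (inj₂ (token-to-leaf (false ∷ false ∷ ⁅ j ⁆) (false ∷ true ∷ ⁅ j ⁆)
    (suc zero)
    (cong (λ s → false ∷ true ∷ s) (△-self ⁅ j ⁆)))))
dominatingSet-dominates k (false ∷ false ∷ false ∷ r , p)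
  with x , y , x≢y , refl ← ∣p∣≡2⇒p≡⁅x⁆∪⁅y⁆ r p =
  there (Any.tabulate⁺ x (inj₂ (token-to-leaf (false ∷ false ∷ ⁅ x ⁆) (false ∷ false ∷ (⁅ x ⁆ ∪ ⁅ y ⁆))
    (suc (suc y))
    (cong (λ s → false ∷ false ∷ s) (⁅x⁆△⁅x⁆∪⁅y⁆≡⁅y⁆ x≢y)))))

dominatingSet-unique : ∀ k → Unique (dominatingSet k)
dominatingSet-unique k = All.tabulate⁺ (λ _ ()) ∷
  Unique.tabulate⁺ (Fin.suc-injective ∘ Fin.suc-injective ∘ hubPair-injective)

theorem3p1 : (n : ℕ) → 2 ≤ n → DominationNumber (TokenGraph (StarAdj {n}) 2) (n ∸ 1)
theorem3p1 (suc (suc k)) (s≤s (s≤s z≤n)) =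
  (dominatingSet k , (dominatingSet-unique k , dominatingSet-dominates k) ,
   cong suc (length-tabulate _)) ,
  F₂S-domination-≥ (suc k)
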